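{- If a finite DAG $G$ with leaf set $X$ has the $\mathrm{lca}$-property, then its clustering system $\mathscr{C}_G$ is closed, i.e. for every non-empty $A\subseteq X$ we have $A\in\mathscr{C}_G$ if and only if $\mathrm{cl}(A)=A$ (equivalently, for all $A,B\in\mathscr{C}_G$ with $A\cap B\ne\emptyset$, $A\cap B\in\mathscr{C}_G$).
   Context: For a finite DAG $G$, write $v\preceq w$ if there is a directed path (possibly of length $0$) from $w$ to $v$; the leaf set $X$ is the set of $\preceq$-minimal vertices; $\mathrm{C}(v)=\{x\in X\mid x\preceq v\}$ and $\mathscr{C}_G=\{\mathrm{C}(v)\mid v\in V(G)\}$. A least common ancestor of $Y\subseteq V(G)$ is a $\preceq$-minimal element of the set of common ancestors of all elements of $Y$; $\mathrm{lca}(Y)$ is defined if there is exactly one such vertex. $G$ has the $\mathrm{lca}$-property if $\mathrm{lca}(A)$ is defined for every non-empty $A\subseteq X$. The closure function of $\mathscr{C}_G$ is $\mathrm{cl}(A)=\bigcap\{C\in\mathscr{C}_G\mid A\subseteq C\}$. -}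

module Defs where

open import Data.Nat using (ℕ)
open import Data.Fin using (Fin)
open import Data.Bool using (Bool; true)
open import Data.Product using (Σ; _×_; ∃-syntax)
open import Relation.Binary.PropositionalEquality using (_≡_)
open import Relation.Binary.Construct.Closure.ReflexiveTransitive using (Star)
open import Relation.Nullary using (¬_)
open import Function.Bundles using (_⇔_)

record Graph (n : ℕ) : Set where
  field
    E : Fin n → Fin n → Bool

module _ {n : ℕ} (G : Graph n) where
  open Graph G

  Arc : Fin n → Fin n → Set
  Arc u v = E u v ≡ true

  _⪯_ : Fin n → Fin n → Set
  v ⪯ w = Star Arc w v

  IsDAG : Set
  IsDAG = ∀ u v → Arc u v → ¬ (u ⪯ v)

  IsLeaf : Fin n → Set
  IsLeaf x = ∀ v → v ⪯ x → v ≡ x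

  VSet : Set₁
  VSet = Fin n → Set

  _⊆_ : VSet → VSet → Set
  A ⊆ B = ∀ x → A x → B x

  _≐_ : VSet → VSet → Set
  A ≐ B = ∀ x → A x ⇔ B x

  NonEmpty : VSet → Set
  NonEmpty A = ∃[ x ] A x

  LeafSet : VSet → Set
  LeafSet A = A ⊆ IsLeaf

  C : Fin n → VSet
  C v x = IsLeaf x × (x ⪯ v)

  InClustering : VSet → Set
  InClustering A = ∃[ v ] (A ≐ C v)

  cl : VSet → VSet
  cl A x = ∀ v → A ⊆ C v → C v x

  CommonAnc : VSet → Fin n → Set
  CommonAnc Y w = ∀ y → Y y → y ⪯ w

  IsLCA : VSet → Fin n → Set
  IsLCA Y w = CommonAnc Y w × (∀ u → CommonAnc Y u → u ⪯ w → u ≡ w)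

  LcaDefined : VSet → Set
  LcaDefined Y = Σ (Fin n) λ w → IsLCA Y w × (∀ u → IsLCA Y u → u ≡ w)

  HasLcaProperty : Set₁
  HasLcaProperty = ∀ (A : VSet) → NonEmpty A → LeafSet A → LcaDefined A

  IsClosed : Set₁
  IsClosed = ∀ (A : VSet) → NonEmpty A → LeafSet A → InClustering A ⇔ (cl A ≐ A)

-- In a finite DAG the descendant order is a partial order on a finite set, hence well-founded;
-- so below every common ancestor w of A there is a minimal common ancestor, i.e. a least common
-- ancestor, which by uniqueness is lca(A). Thus lca(A) ⪯ w for every w with A ⊆ C(w), giving
-- C(lca A) ⊆ cl(A). If cl(A) = A this shows A = C(lca A); conversely cl(C v) ⊆ C v trivially.
-- The minimal element exists only under a double negation (the set of common ancestors is not
-- decidable), which is harmless because reachability in a finite DAG is decidable.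
module Submission where

open import Defs
open import Data.Nat using (ℕ)
open import Data.Fin using (Fin; _≟_)
open import Data.Fin.Induction using (po-wellFounded)
open import Data.Fin.Properties using (any?)
open import Data.Bool using (true)
open import Data.Bool.Properties using () renaming (_≟_ to _≟ᵇ_)
open import Data.Product using (_×_; _,_; proj₁; proj₂; ∃-syntax)
open import Data.Empty using (⊥-elim)
open import Function using (_∘_)
open import Function.Bundles using (mk⇔; Equivalence)
open import Level using (Level; _⊔_)
open import Induction.WellFounded using (WfRec; module All)
open import Relation.Binary.Core using (Rel)
open import Relation.Binary.Definitions using (Decidable)
open import Relation.Binary.Structures using (IsPartialOrder; module IsPartialOrder)
import Relation.Binary.Construct.NonStrictToStrict as ToStrict
open import Relation.Binary.PropositionalEquality using (_≡_; refl; subst; isEquivalence)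
open import Relation.Binary.Construct.Closure.ReflexiveTransitive using (ε; _◅_; _◅◅_)
open import Relation.Nullary using (¬_; Dec; yes; no; map′; ¬¬-excluded-middle; decidable-stable)
open import Relation.Unary using (Pred)

open Equivalence

module _ {n : ℕ} {r ℓ : Level} {_⊑_ : Rel (Fin n) r} (isPO : IsPartialOrder _≡_ _⊑_) where
  open IsPartialOrder isPO using (trans) renaming (refl to ⊑-refl)
  open ToStrict _≡_ _⊑_ using (_<_)

  MinimalBelow : Pred (Fin n) ℓ → Fin n → Set (r ⊔ ℓ)
  MinimalBelow Q w = ∃[ m ] Q m × m ⊑ w × (∀ u → Q u → u ⊑ m → u ≡ m)

  minimal-if-nothing-below : {Q : Pred (Fin n) ℓ} {w : Fin n} → ¬ (∃[ u ] Q u × u < w) →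
                             ∀ u → Q u → u ⊑ w → u ≡ w
  minimal-if-nothing-below {w = w} noneBelow u qu u⊑w with u ≟ w
  ... | yes u≡w = u≡w
  ... | no u≢w = ⊥-elim (noneBelow (u , qu , u⊑w , u≢w))

  ¬¬-minimal-below : (Q : Pred (Fin n) ℓ) (w : Fin n) → Q w → ¬ ¬ MinimalBelow Q w
  ¬¬-minimal-below Q = All.wfRec (po-wellFounded isPO) (r ⊔ ℓ) _ step
    where
    step : ∀ w → WfRec _<_ (λ w → Q w → ¬ ¬ MinimalBelow Q w) w → Q w → ¬ ¬ MinimalBelow Q w
    step w below qw noMinimal = ¬¬-excluded-middle {A = ∃[ u ] Q u × u < w} λ where
      (yes (u , qu , u<w)) → below u<w qu λ (m , qm , m⊑u , minimal) →
        noMinimal (m , qm , trans m⊑u (proj₁ u<w) , minimal)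
      (no noneBelow) → noMinimal (w , qw , ⊑-refl , minimal-if-nothing-below noneBelow)

module _ {n : ℕ} (G : Graph n) {A : VSet G} where

  ⊆-cl : _⊆_ G A (cl G A)
  ⊆-cl x a v A⊆Cv = A⊆Cv x a

  cl-cluster : InClustering G A → _≐_ G (cl G A) A
  cl-cluster (v , A≐Cv) x = mk⇔ (λ x∈clA → from (A≐Cv x) (x∈clA v (λ y → to (A≐Cv y)))) (⊆-cl x)

module _ {n : ℕ} (G : Graph n) (dag : IsDAG G) where
  open Graph G

  ⪯-antisym : ∀ {v w} → _⪯_ G v w → _⪯_ G w v → v ≡ w
  ⪯-antisym ε _ = refl
  ⪯-antisym (e ◅ v⪯c) w⪯v = ⊥-elim (dag _ _ e (v⪯c ◅◅ w⪯v))

  ⪯-isPartialOrder : IsPartialOrder _≡_ (_⪯_ G)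
  ⪯-isPartialOrder = record
    { isPreorder = record
      { isEquivalence = isEquivalence
      ; reflexive = λ { refl → ε }
      ; trans = λ u⪯v v⪯w → v⪯w ◅◅ u⪯v
      }
    ; antisym = ⪯-antisym
    }

  open ToStrict _≡_ (_⪯_ G) using () renaming (_<_ to _≺_)

  arc⇒≺ : ∀ {w c} → Arc G w c → c ≺ w
  arc⇒≺ {w} e = e ◅ ε , λ { refl → dag w w e ε }

  ⪯-dec : Decidable (_⪯_ G)
  ⪯-dec x w = All.wfRec (po-wellFounded ⪯-isPartialOrder) _ _ step w x
    where
    step : ∀ w → WfRec _≺_ (λ w → ∀ x → Dec (_⪯_ G x w)) w → ∀ x → Dec (_⪯_ G x w)
    step w below x with x ≟ w
    ... | yes refl = yes ε
    ... | no x≢w = map′ (λ (_ , e , x⪯c) → e ◅ x⪯c) viaSuccessor (any? successor?)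
      where
      successor? : ∀ c → Dec (Arc G w c × _⪯_ G x c)
      successor? c with E w c ≟ᵇ true
      ... | yes e = map′ (e ,_) proj₂ (below (arc⇒≺ e) x)
      ... | no ¬e = no (¬e ∘ proj₁)
      viaSuccessor : _⪯_ G x w → ∃[ c ] Arc G w c × _⪯_ G x c
      viaSuccessor ε = ⊥-elim (x≢w refl)
      viaSuccessor (e ◅ x⪯c) = _ , e , x⪯c

  lca-⪯-commonAnc : ∀ {A w} (lcaA : LcaDefined G A) → CommonAnc G A w → _⪯_ G (proj₁ lcaA) w
  lca-⪯-commonAnc {A} {w} (v , _ , unique) wAnc = decidable-stable (⪯-dec v w) λ v⋠w →
    ¬¬-minimal-below ⪯-isPartialOrder (CommonAnc G A) w wAnc λ (m , mAnc , m⪯w , minimal) →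
      v⋠w (subst (λ u → _⪯_ G u w) (unique m (mAnc , minimal)) m⪯w)

  cluster-lca-⊆-cl : ∀ {A} (lcaA : LcaDefined G A) → _⊆_ G (C G (proj₁ lcaA)) (cl G A)
  cluster-lca-⊆-cl lcaA x (leaf , x⪯v) w A⊆Cw =
    leaf , lca-⪯-commonAnc lcaA (λ y a → proj₂ (A⊆Cw y a)) ◅◅ x⪯v

  closed⇒cluster : ∀ {A} → LeafSet G A → LcaDefined G A → _≐_ G (cl G A) A → InClustering G A
  closed⇒cluster A⊆X lcaA@(v , (vAnc , _) , _) clA≐A =
    v , λ x → mk⇔ (λ a → A⊆X x a , vAnc x a) (to (clA≐A x) ∘ cluster-lca-⊆-cl lcaA x)

lemma3 : ∀ (n : ℕ) (G : Graph n) → IsDAG G → HasLcaProperty G → IsClosed G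
lemma3 n G dag lcaProperty A nonEmpty A⊆X =
  mk⇔ (cl-cluster G) (closed⇒cluster G dag A⊆X (lcaProperty A nonEmpty A⊆X))
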